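{- Let $g:\langle {}^{<\omega}2,\supseteq\rangle\to\langle{}^{<\omega}\omega,\supseteq\rangle$ be an embedding, i.e. an injective map such that for all $\varphi,\psi\in{}^{<\omega}2$, $\varphi\supseteq\psi$ iff $g(\varphi)\supseteq g(\psi)$. Then the set $g[{}^{<\omega}2]\!\uparrow=\{\psi\in{}^{<\omega}\omega:\exists\varphi\in{}^{<\omega}2\ g(\varphi)\supseteq\psi\}$ is a binary subtree of ${}^{<\omega}\omega$, i.e. a subset closed under initial segments in which every element has at most two immediate successors.
   Context: ${}^{<\omega}2$ and ${}^{<\omega}\omega$ are the sets of finite sequences of elements of $2=\{0,1\}$ and of $\omega$ respectively, ordered by reverse inclusion (end-extension). -}

module Defs where

open import Data.Bool using (Bool)
open import Data.Nat using (ℕ)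
open import Data.List using (List; _++_; _∷ʳ_)
open import Data.Product using (Σ; ∃; _×_)
open import Data.Sum using (_⊎_)
open import Relation.Binary.PropositionalEquality using (_≡_)
open import Function.Bundles using (_⇔_)

-- Finite sequences: ^{<ω}2 = List Bool, ^{<ω}ω = List ℕ.
-- φ ⊇ ψ  (φ end-extends ψ, i.e. ψ is an initial segment of φ).
_⊇_ : {A : Set} → List A → List A → Set
φ ⊇ ψ = ∃ λ ξ → ψ ++ ξ ≡ φ

IsEmbedding : (List Bool → List ℕ) → Set
IsEmbedding g =
  ((φ ψ : List Bool) → g φ ≡ g ψ → φ ≡ ψ) ×
  ((φ ψ : List Bool) → (φ ⊇ ψ) ⇔ (g φ ⊇ g ψ))

UpImage : (List Bool → List ℕ) → List ℕ → Set
UpImage g ψ = ∃ λ (φ : List Bool) → g φ ⊇ ψ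

ClosedUnderInitialSegments : (List ℕ → Set) → Set
ClosedUnderInitialSegments T = (σ τ : List ℕ) → T σ → σ ⊇ τ → T τ

AtMostTwoSuccessors : (List ℕ → Set) → Set
AtMostTwoSuccessors T = (σ : List ℕ) → T σ → (a b c : ℕ) →
  T (σ ∷ʳ a) → T (σ ∷ʳ b) → T (σ ∷ʳ c) → a ≡ b ⊎ a ≡ c ⊎ b ≡ c

IsBinarySubtree : (List ℕ → Set) → Set
IsBinarySubtree T = ClosedUnderInitialSegments T × AtMostTwoSuccessors T

module Submission where

-- Proof idea.  Say that u and v split at σ if σ ∷ʳ a ⊆ u and σ ∷ʳ b ⊆ v
-- for some a ≢ b.  Split sequences are incomparable, and every common
-- initial segment of them is an initial segment of σ.
--
-- Suppose σ had three distinct immediate successors σ ∷ʳ a, σ ∷ʳ b, σ ∷ʳ c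
-- in g[²<ω]↑, witnessed by g φa, g φb, g φc.  Any two of these images split
-- at σ, so, since g reflects ⊇, the binary strings φa, φb, φc are pairwise
-- incomparable, and any common initial segment χ of two of them is an
-- initial segment of the third (g χ lies below σ, hence below the third
-- image).  This is impossible for binary strings: if φa, φb diverge after χ
-- with bits i ≢ j, then χ ⊆ φc properly, and the next bit of φc is i or j,
-- giving a common initial segment χ ∷ʳ i of φa, φc not below φb (or
-- symmetrically).  Downward closure of g[²<ω]↑ is just transitivity of ⊇.

open import Defs
open import Data.Bool using (Bool; true; false)
import Data.Bool.Properties as Bool
open import Data.Nat using (ℕ)
open import Data.Nat.Properties using (_≟_)
open import Data.List using (List; []; _∷_; _++_; _∷ʳ_; [_])
open import Data.List.Properties using (++-assoc; ++-identityʳ; ∷-injectiveˡ; ∷-injectiveʳ)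
open import Data.Product using (∃-syntax; _×_; _,_; proj₁; proj₂)
open import Data.Sum using (_⊎_; inj₁; inj₂)
open import Data.Empty using (⊥; ⊥-elim)
open import Relation.Nullary using (¬_; yes; no)
open import Relation.Binary.Definitions using (DecidableEquality)
open import Relation.Binary.PropositionalEquality using (_≡_; _≢_; refl; sym; trans; cong)
open import Function using (_∘_)
open import Function.Bundles using (Equivalence)

module _ {A : Set} where

  ⊇-trans : {x y z : List A} → x ⊇ y → y ⊇ z → x ⊇ z
  ⊇-trans {z = z} (ρ′ , refl) (ρ , refl) = ρ ++ ρ′ , sym (++-assoc z ρ ρ′)

  ∷ʳ-extends : (σ : List A) (a : A) → (σ ∷ʳ a) ⊇ σ
  ∷ʳ-extends σ a = [ a ] , refl

  ∷-mono : {s : A} {x y : List A} → x ⊇ y → (s ∷ x) ⊇ (s ∷ y)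
  ∷-mono {s} (ξ , p) = ξ , cong (s ∷_) p

  ⊇-uncons : {s t : A} {x y : List A} → (s ∷ x) ⊇ (t ∷ y) → t ≡ s × x ⊇ y
  ⊇-uncons (ξ , p) = ∷-injectiveˡ p , (ξ , ∷-injectiveʳ p)

  successor-unique : (σ : List A) {a b : A} {v : List A} →
                     v ⊇ (σ ∷ʳ a) → v ⊇ (σ ∷ʳ b) → a ≡ b
  successor-unique []      (ξ , refl) (η , p) = sym (∷-injectiveˡ p)
  successor-unique (s ∷ σ) (ξ , refl) vb      =
    successor-unique σ (ξ , refl) (proj₂ (⊇-uncons vb))

  extension-cases : {φ χ : List A} → φ ⊇ χ → φ ≡ χ ⊎ ∃[ k ] φ ⊇ (χ ∷ʳ k)
  extension-cases {χ = χ} ([]    , p) = inj₁ (trans (sym p) (++-identityʳ χ))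
  extension-cases {χ = χ} (k ∷ ρ , p) = inj₂ (k , ρ , trans (++-assoc χ [ k ] ρ) p)

  Incomparable : List A → List A → Set
  Incomparable x y = ¬ x ⊇ y × ¬ y ⊇ x

  SplitAt : List A → List A → List A → Set
  SplitAt σ u v = ∃[ a ] ∃[ b ] a ≢ b × u ⊇ (σ ∷ʳ a) × v ⊇ (σ ∷ʳ b)

  split-sym : {σ u v : List A} → SplitAt σ u v → SplitAt σ v u
  split-sym (a , b , a≢b , ua , vb) = b , a , (λ e → a≢b (sym e)) , vb , ua

  split-incomparable : {σ u v : List A} → SplitAt σ u v → Incomparable u v
  split-incomparable {σ} s = not-below s , not-below (split-sym s)
    where
    not-below : {u v : List A} → SplitAt σ u v → ¬ u ⊇ v
    not-below (a , b , a≢b , ua , vb) u⊇v =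
      a≢b (successor-unique σ ua (⊇-trans u⊇v vb))

  split-common-below : {σ τ u v : List A} → SplitAt σ u v → u ⊇ τ → v ⊇ τ → σ ⊇ τ
  split-common-below {σ} {[]}    _ _ _ = σ , refl
  split-common-below {[]} {t ∷ τ} (a , b , a≢b , (ξ , refl) , (η , refl)) uτ vτ =
    ⊥-elim (a≢b (trans (sym (proj₁ (⊇-uncons uτ))) (proj₁ (⊇-uncons vτ))))
  split-common-below {s ∷ σ} {t ∷ τ} (a , b , a≢b , (ξ , refl) , (η , refl)) uτ vτ
    with ⊇-uncons uτ | ⊇-uncons vτ
  ... | refl , uτ′ | _ , vτ′ =
    ∷-mono (split-common-below (a , b , a≢b , (ξ , refl) , (η , refl)) uτ′ vτ′)

  -- Over a type with decidable equality, incomparable sequences split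
  -- at their longest common initial segment.
  incomparable-split : DecidableEquality A → (x y : List A) →
                       Incomparable x y → ∃[ χ ] SplitAt χ x y
  incomparable-split _≟A_ []      y       (_ , y⋡x) = ⊥-elim (y⋡x (y , refl))
  incomparable-split _≟A_ (a ∷ x) []      (x⋡y , _) = ⊥-elim (x⋡y (a ∷ x , refl))
  incomparable-split _≟A_ (a ∷ x) (b ∷ y) (x⋡y , y⋡x) with a ≟A b
  ... | no a≢b = [] , a , b , a≢b , (x , refl) , (y , refl)
  ... | yes refl with incomparable-split _≟A_ x y (x⋡y ∘ ∷-mono , y⋡x ∘ ∷-mono)
  ...   | χ , i , j , i≢j , xi , yj = a ∷ χ , i , j , i≢j , ∷-mono xi , ∷-mono yj

bit-cases : {i j : Bool} → i ≢ j → (k : Bool) → k ≡ i ⊎ k ≡ j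
bit-cases {false} {false} i≢j _     = ⊥-elim (i≢j refl)
bit-cases {false} {true}  _   false = inj₁ refl
bit-cases {false} {true}  _   true  = inj₂ refl
bit-cases {true}  {false} _   false = inj₂ refl
bit-cases {true}  {false} _   true  = inj₁ refl
bit-cases {true}  {true}  i≢j _     = ⊥-elim (i≢j refl)

CommonBelow : List Bool → List Bool → List Bool → Set
CommonBelow φ ψ θ = (χ : List Bool) → φ ⊇ χ → ψ ⊇ χ → θ ⊇ χ

-- The binary tree has no incomparable φ₁, φ₂ and a third node φ₃ ⋢ φ₁
-- such that the common initial segments of any two lie below the third:
-- φ₃ would have to continue the divergence point of φ₁, φ₂ by a bit shared
-- with one of them.
no-three-branches : (φ₁ φ₂ φ₃ : List Bool) → Incomparable φ₁ φ₂ → ¬ φ₁ ⊇ φ₃ →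
  CommonBelow φ₁ φ₂ φ₃ → CommonBelow φ₁ φ₃ φ₂ → CommonBelow φ₂ φ₃ φ₁ → ⊥
no-three-branches φ₁ φ₂ φ₃ inc₁₂ φ₁⋡φ₃ below₃ below₂ below₁
  with incomparable-split Bool._≟_ φ₁ φ₂ inc₁₂
... | χ , i , j , i≢j , φ₁i , φ₂j
  with extension-cases (below₃ χ (⊇-trans φ₁i (∷ʳ-extends χ i))
                                 (⊇-trans φ₂j (∷ʳ-extends χ j)))
... | inj₁ refl = φ₁⋡φ₃ (⊇-trans φ₁i (∷ʳ-extends χ i))
... | inj₂ (k , φ₃k) with bit-cases i≢j k
...   | inj₁ refl = i≢j (successor-unique χ (below₂ (χ ∷ʳ k) φ₁i φ₃k) φ₂j)
...   | inj₂ refl = i≢j (successor-unique χ φ₁i (below₁ (χ ∷ʳ k) φ₂j φ₃k))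

upImage-closed : (g : List Bool → List ℕ) → ClosedUnderInitialSegments (UpImage g)
upImage-closed g σ τ (φ , gφ⊇σ) σ⊇τ = φ , ⊇-trans gφ⊇σ σ⊇τ

module Embedding (g : List Bool → List ℕ) (E : IsEmbedding g) (σ : List ℕ) where

  monotone : (φ ψ : List Bool) → φ ⊇ ψ → g φ ⊇ g ψ
  monotone φ ψ = Equivalence.to (proj₂ E φ ψ)

  reflecting : (φ ψ : List Bool) → g φ ⊇ g ψ → φ ⊇ ψ
  reflecting φ ψ = Equivalence.from (proj₂ E φ ψ)

  preimages-incomparable : {a b : ℕ} {φa φb : List Bool} → a ≢ b →
    g φa ⊇ (σ ∷ʳ a) → g φb ⊇ (σ ∷ʳ b) → Incomparable φa φb
  preimages-incomparable {a} {b} {φa} {φb} a≢b ha hb with split-incomparable (a , b , a≢b , ha , hb)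
  ... | ga⋡gb , gb⋡ga = ga⋡gb ∘ monotone φa φb , gb⋡ga ∘ monotone φb φa

  -- A common initial segment χ of the preimages has g χ ⊆ σ, so it lies
  -- below any node whose image extends σ.
  preimages-common-below : {a b c : ℕ} {φa φb φc : List Bool} → a ≢ b →
    g φa ⊇ (σ ∷ʳ a) → g φb ⊇ (σ ∷ʳ b) → g φc ⊇ (σ ∷ʳ c) → CommonBelow φa φb φc
  preimages-common-below {a} {b} {c} {φa} {φb} {φc} a≢b ha hb hc χ φa⊇χ φb⊇χ =
    reflecting φc χ (⊇-trans (⊇-trans hc (∷ʳ-extends σ c)) σ⊇gχ)
    where
    σ⊇gχ : σ ⊇ g χ
    σ⊇gχ = split-common-below (a , b , a≢b , ha , hb)
             (monotone φa χ φa⊇χ) (monotone φb χ φb⊇χ)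

lemma3p2 : (g : List Bool → List ℕ) → IsEmbedding g → IsBinarySubtree (UpImage g)
lemma3p2 g E = upImage-closed g , atMostTwo
  where
  atMostTwo : AtMostTwoSuccessors (UpImage g)
  atMostTwo σ _ a b c (φa , ha) (φb , hb) (φc , hc) with a ≟ b | a ≟ c | b ≟ c
  ... | yes a≡b | _        | _        = inj₁ a≡b
  ... | no _    | yes a≡c  | _        = inj₂ (inj₁ a≡c)
  ... | no _    | no _     | yes b≡c  = inj₂ (inj₂ b≡c)
  ... | no a≢b  | no a≢c   | no b≢c   = ⊥-elim (no-three-branches φa φb φc
          (incomparable a≢b ha hb) (proj₁ (incomparable a≢c ha hc))
          (below a≢b ha hb hc) (below a≢c ha hc hb) (below b≢c hb hc ha))
    where open Embedding g E σ renaming (preimages-incomparable to incomparable;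
                                          preimages-common-below to below)
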